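{- For any graph $G$ with minimum degree $\delta(G)$, if $\mathrm{Z}(G)=\delta(G)$, then $\mathrm{H}(G)=\delta(G)+1$.
   Context: All graphs are finite, simple and undirected; $N(v)$ is the open neighborhood of $v$. Vertices are colored blue or white; starting from an initial blue set $B$, forces are applied one at a time until no further force is possible, and $B$ is a forcing set (for a given rule) if some such sequence turns every vertex blue. Standard color change rule: a blue vertex $v$ may force a white vertex $w$ if $w$ is the unique white neighbor of $v$; $\mathrm{Z}(G)$ is the minimum size of a forcing set under this rule. Hopping color change rule: a blue vertex $v$ may force any white vertex $w$ (not necessarily adjacent) if $v$ has not previously performed a force and every vertex of $N(v)$ is blue; $\mathrm{H}(G)$ is the minimum size of a forcing set under this rule. -}

module Defs where

open import Data.Nat using (ℕ; zero; suc; _+_; _≤_)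
open import Data.Fin using (Fin; zero; suc; _≟_)
open import Data.Bool using (Bool; true; false; if_then_else_; _∨_)
open import Data.Product using (Σ; _×_; _,_)
open import Relation.Binary.PropositionalEquality using (_≡_; _≢_)
open import Relation.Nullary.Decidable using (⌊_⌋)

record Graph (n : ℕ) : Set where
  field
    adj    : Fin n → Fin n → Bool
    sym    : ∀ u v → adj u v ≡ adj v u
    irrefl : ∀ v → adj v v ≡ false
open Graph public

-- Vertex sets as Boolean predicates (true = member / blue).
VSet : ℕ → Set
VSet n = Fin n → Bool

count : ∀ {n} → VSet n → ℕ
count {zero}  f = 0
count {suc n} f = (if f zero then 1 else 0) + count (λ i → f (suc i))

insert : ∀ {n} → Fin n → VSet n → VSet n
insert w S u = ⌊ u ≟ w ⌋ ∨ S u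

deg : ∀ {n} → Graph n → Fin n → ℕ
deg G v = count (adj G v)

IsMinDegree : ∀ {n} → Graph n → ℕ → Set
IsMinDegree {n} G d = Σ (Fin n) (λ v → deg G v ≡ d) × (∀ v → d ≤ deg G v)

-- Standard color change rule: a blue v forces w if w is the unique white neighbor of v.
-- ZForces G B : starting from blue set B, some sequence of forces turns every vertex blue.
data ZForces {n : ℕ} (G : Graph n) : VSet n → Set where
  done  : ∀ {B} → (∀ u → B u ≡ true) → ZForces G B
  force : ∀ {B} (v w : Fin n) →
          B v ≡ true → B w ≡ false → adj G v w ≡ true →
          (∀ u → adj G v u ≡ true → u ≢ w → B u ≡ true) →
          ZForces G (insert w B) → ZForces G B

-- Hopping color change rule: a blue v that has not yet forced and whose whole
-- neighborhood is blue may force any white w.  The second index records the set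
-- of vertices that have already performed a force.
data HForces' {n : ℕ} (G : Graph n) : VSet n → VSet n → Set where
  done  : ∀ {B F} → (∀ u → B u ≡ true) → HForces' G B F
  force : ∀ {B F} (v w : Fin n) →
          B v ≡ true → F v ≡ false → B w ≡ false →
          (∀ u → adj G v u ≡ true → B u ≡ true) →
          HForces' G (insert w B) (insert v F) → HForces' G B F

HForces : ∀ {n} → Graph n → VSet n → Set
HForces G B = HForces' G B (λ _ → false)

IsMinForcing : ∀ {n} → (VSet n → Set) → ℕ → Set
IsMinForcing {n} P k =
  Σ (VSet n) (λ B → count B ≡ k × P B) × (∀ B → P B → k ≤ count B)

IsZ : ∀ {n} → Graph n → ℕ → Set
IsZ G = IsMinForcing (ZForces G)

IsH : ∀ {n} → Graph n → ℕ → Set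
IsH G = IsMinForcing (HForces G)

{-# OPTIONS --safe #-}
-- For H(G) ≥ δ + 1: the first hop of a hopping process, or the end of a process that needs no
-- hop at all, requires some vertex together with its whole neighbourhood to be blue.
-- For H(G) ≤ δ + 1: take a standard forcing set B of size δ; it is not all of G, so its first
-- force v → w exists, and then B ∪ {w} is a hopping forcing set.  The hopping process replays
-- the standard one while keeping one spare vertex that is blue, has not hopped and has an all-blue
-- neighbourhood (initially v): when the standard process forces v′ → w′, the spare vertex hops
-- to w′, after which v′, whose only white neighbour was w′, becomes the spare vertex.
module Submission where

open import Defs
open import Data.Nat using (ℕ; suc; zero; _+_; _≤_; z≤n; s≤s)
open import Data.Nat.Properties using (≤-trans; ≤-reflexive; n≤1+n; n≮n)
open import Data.Fin using (Fin; zero; suc; _≟_)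
open import Data.Bool using (true; false)
open import Data.Product using (Σ-syntax; _×_; _,_)
open import Function using (_∘_)
open import Relation.Nullary using (¬_; yes; no)
open import Relation.Nullary.Decidable using (isYes≗does; dec-false)
open import Relation.Binary.PropositionalEquality
  using (_≡_; _≢_; refl; cong; trans) renaming (sym to ≡-sym)

private
  variable
    n : ℕ

infix 4 _⊆_

_⊆_ : VSet n → VSet n → Set
S ⊆ T = ∀ u → S u ≡ true → T u ≡ true

closedNeighbourhood : Graph n → Fin n → VSet n
closedNeighbourhood G v = insert v (adj G v)

insert-other : (w : Fin n) (S : VSet n) {u : Fin n} → u ≢ w → insert w S u ≡ S u
insert-other w S {u} u≢w rewrite isYes≗does (u ≟ w) | dec-false (u ≟ w) u≢w = refl

⊆-insert : (w : Fin n) (S : VSet n) → S ⊆ insert w S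
⊆-insert w S u Su with u ≟ w
... | yes _ = refl
... | no  _ = Su

insert-⊆ : {w : Fin n} {S T : VSet n} → T w ≡ true → S ⊆ T → insert w S ⊆ T
insert-⊆ {w = w} Tw S⊆T u _ with u ≟ w
insert-⊆ Tw S⊆T u _  | yes refl = Tw
insert-⊆ Tw S⊆T u Su | no  _    = S⊆T u Su

⊆-insert-of-⊆-except : (w : Fin n) {S T : VSet n} →
                       (∀ u → S u ≡ true → u ≢ w → T u ≡ true) → S ⊆ insert w T
⊆-insert-of-⊆-except w S⊆T u Su with u ≟ w
... | yes refl = refl
... | no  u≢w  = S⊆T u Su u≢w

insert-suc : (v : Fin n) (S : VSet (suc n)) (u : Fin n) →
             insert (suc v) S (suc u) ≡ insert v (S ∘ suc) u
insert-suc v S u with u ≟ v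
... | yes _ = refl
... | no  _ = refl

count-cong : {S T : VSet n} → (∀ u → S u ≡ T u) → count S ≡ count T
count-cong {zero}  S≗T = refl
count-cong {suc n} S≗T rewrite S≗T zero = cong (_ +_) (count-cong (S≗T ∘ suc))

count-mono : {S T : VSet n} → S ⊆ T → count S ≤ count T
count-mono {zero} S⊆T = z≤n
count-mono {suc n} {S} {T} S⊆T with S zero | T zero | S⊆T zero
... | true  | true  | _ = s≤s (count-mono (S⊆T ∘ suc))
... | false | true  | _ = ≤-trans (count-mono (S⊆T ∘ suc)) (n≤1+n _)
... | false | false | _ = count-mono (S⊆T ∘ suc)
... | true  | false | S0⇒T0 with () ← S0⇒T0 refl

count-insert : (w : Fin n) (S : VSet n) → S w ≡ false → count (insert w S) ≡ suc (count S)
count-insert zero S Sw≡false rewrite Sw≡false =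
  cong suc (count-cong λ u → insert-other zero S {suc u} λ ())
count-insert (suc w) S Sw≡false
  rewrite insert-other (suc w) S {zero} (λ ())
        | count-cong (insert-suc w S)
        | count-insert w (S ∘ suc) Sw≡false
  with S zero
... | true  = refl
... | false = refl

count-closedNeighbourhood : (G : Graph n) (v : Fin n) →
                            count (closedNeighbourhood G v) ≡ suc (deg G v)
count-closedNeighbourhood G v = count-insert v (adj G v) (irrefl G v)

minDegree<count : (G : Graph n) {δ : ℕ} {S : VSet n} (v : Fin n) → (∀ u → δ ≤ deg G u) →
                  closedNeighbourhood G v ⊆ S → suc δ ≤ count S
minDegree<count G v δ≤deg N[v]⊆S =
  ≤-trans (s≤s (δ≤deg v))
    (≤-trans (≤-reflexive (≡-sym (count-closedNeighbourhood G v))) (count-mono N[v]⊆S))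

count≤minDegree⇒¬all : (G : Graph n) {δ : ℕ} {S : VSet n} → Fin n → (∀ u → δ ≤ deg G u) →
                       count S ≤ δ → ¬ (∀ u → S u ≡ true)
count≤minDegree⇒¬all G {δ} v δ≤deg |S|≤δ allInS =
  n≮n δ (≤-trans (minDegree<count G v δ≤deg (λ u _ → allInS u)) |S|≤δ)

module _ (G : Graph n) where

  hForcing⇒closedNeighbourhood-⊆ : {B F : VSet n} → Fin n → HForces' G B F →
                                   Σ[ v ∈ Fin n ] closedNeighbourhood G v ⊆ B
  hForcing⇒closedNeighbourhood-⊆ v (done allBlue) = v , λ u _ → allBlue u
  hForcing⇒closedNeighbourhood-⊆ _ (force v _ Bv _ _ N[v]⊆B _) = v , insert-⊆ Bv N[v]⊆B

  zForcing⇒hForcing : {B F : VSet n} (spare : Fin n) → ZForces G B →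
                      B spare ≡ true → F spare ≡ false → adj G spare ⊆ B →
                      (∀ u → F u ≡ true → adj G u ⊆ B) → HForces' G B F
  zForcing⇒hForcing _ (done allBlue) _ _ _ _ = done allBlue
  zForcing⇒hForcing {B} {F} spare (force v w Bv Bw≡false vw othersBlue rest)
                    Bspare Fspare≡false N[spare]⊆B forced⇒N⊆B =
    force spare w Bspare Fspare≡false Bw≡false N[spare]⊆B
      (zForcing⇒hForcing v rest (⊆-insert w B v Bv) F′v≡false
        (⊆-insert-of-⊆-except w othersBlue) forced′⇒N⊆B′)
    where
      saturated⇒≢v : ∀ {u} → adj G u ⊆ B → u ≢ v
      saturated⇒≢v N[u]⊆B refl with () ← trans (≡-sym Bw≡false) (N[u]⊆B w vw)

      Fv≡false : F v ≡ false
      Fv≡false with F v in Fv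
      ... | false = refl
      ... | true  with () ← saturated⇒≢v (forced⇒N⊆B v Fv) refl

      F′v≡false : insert spare F v ≡ false
      F′v≡false = trans (insert-other spare F (saturated⇒≢v N[spare]⊆B ∘ ≡-sym)) Fv≡false

      forced′⇒N⊆B′ : ∀ u → insert spare F u ≡ true → adj G u ⊆ insert w B
      forced′⇒N⊆B′ u F′u with u ≟ spare
      ... | yes refl = λ y → ⊆-insert w B y ∘ N[spare]⊆B y
      ... | no  _    = λ y → ⊆-insert w B y ∘ forced⇒N⊆B u F′u y

  zForcing⇒hForcing-insert : {B : VSet n} → ZForces G B → ¬ (∀ u → B u ≡ true) →
                             Σ[ w ∈ Fin n ] B w ≡ false × HForces G (insert w B)
  zForcing⇒hForcing-insert (done allBlue) notAllBlue with () ← notAllBlue allBlue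
  zForcing⇒hForcing-insert {B} (force v w Bv Bw≡false _ othersBlue rest) _ =
    w , Bw≡false ,
    zForcing⇒hForcing v rest (⊆-insert w B v Bv) refl
      (⊆-insert-of-⊆-except w othersBlue) (λ _ ())

corollary2p8 : (n : ℕ) (G : Graph (suc n)) (δ : ℕ) →
    IsMinDegree G δ → IsZ G δ → IsH G (suc δ)
corollary2p8 n G δ ((v₀ , _) , δ≤deg) ((B , |B|≡δ , zForcing) , _)
  with w , Bw≡false , hForcing ← zForcing⇒hForcing-insert G zForcing
                                   (count≤minDegree⇒¬all G v₀ δ≤deg (≤-reflexive |B|≡δ)) =
  (insert w B , trans (count-insert w B Bw≡false) (cong suc |B|≡δ) , hForcing) ,
  λ B′ hForcing′ →
    let v , N[v]⊆B′ = hForcing⇒closedNeighbourhood-⊆ G v₀ hForcing′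
    in minDegree<count G v δ≤deg N[v]⊆B′
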